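{- Let $N$ be a network, and let $N'$ be the semidirected graph obtained from $N$ by undirecting some of the tree edges of $N$. Then $N'$ is a network, and $N$ is phylogenetically compatible with $N'$.
   Context: A semidirected graph is $N=(V,E)$ with $E=E_U\sqcup E_D$, where $E_U$ is a set of undirected edges $uv$ and $E_D$ a set of directed edges $(u,v)$ ($u$ parent, $v$ child); parallel directed edges allowed, no self-loops. A directed graph has $E_U=\emptyset$. $\deg_i(v,N)$ is the number of directed edges with child $v$. $N'$ is compatible with $N$ if $N'$ is obtained from $N$ by directing some undirected edges. A semidirected cycle is a semidirected graph whose undirected edges can be directed so that it becomes a directed cycle; a semidirected graph is acyclic (an SDAG) if it contains no semidirected cycle; a DAG is an acyclic directed graph. A node $v$ is a tree node if $\deg_i(v,N)\le1$ and a hybrid node otherwise. A tree edge is an undirected edge or a directed edge whose child is a tree node; a hybrid edge is a directed edge whose child is a hybrid node; $E_H(N)$ is the set of hybrid edges. An SDAG $N'$ is phylogenetically compatible with an SDAG $N$ if $N'$ is compatible with $N$ and $E_H(N')=E_H(N)$. A rooted partner of $N$ is a DAG phylogenetically compatible with $N$. A network is an SDAG that admits a rooted partner. -}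

module Defs where

open import Data.Nat using (ℕ; zero; suc)
open import Data.Fin using (Fin; zero; suc)
open import Data.Bool using (Bool; true; false)
open import Data.Product using (Σ; ∃; _×_; _,_)
open import Data.Sum using (_⊎_)
open import Relation.Binary.PropositionalEquality using (_≡_; _≢_)
open import Relation.Nullary using (¬_)
open import Function.Definitions using (Injective)
open import Function.Bundles using (_⇔_)

-- An edge on node set Fin n.  'directed = true' : directed edge (end₁ , end₂),
-- end₁ the parent, end₂ the child.  'directed = false' : undirected edge
-- {end₁ , end₂} (the stored order is irrelevant).
record Edge (n : ℕ) : Set where
  constructor edge
  field
    end₁ end₂ : Fin n
    directed  : Bool
open Edge public

-- A (finite) semidirected graph with nodes Fin n and edges indexed by Fin m
-- (edge identities are kept, so parallel directed edges are allowed).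
SGraph : ℕ → ℕ → Set
SGraph n m = Fin m → Edge n

SamePair : ∀ {n} → Edge n → Edge n → Set
SamePair e f = (end₁ e ≡ end₁ f × end₂ e ≡ end₂ f) ⊎ (end₁ e ≡ end₂ f × end₂ e ≡ end₁ f)

-- well-formedness: no self-loops, and E_U is a set (no two distinct
-- undirected edges on the same pair of nodes)
WellFormed : ∀ {n m} → SGraph n m → Set
WellFormed {n} {m} G =
  (∀ (e : Fin m) → end₁ (G e) ≢ end₂ (G e)) ×
  (∀ (e f : Fin m) → e ≢ f → directed (G e) ≡ false → directed (G f) ≡ false →
     ¬ SamePair (G e) (G f))

IsDirected : ∀ {n m} → SGraph n m → Set
IsDirected {n} {m} G = ∀ (e : Fin m) → directed (G e) ≡ true

Step : ∀ {n} → Edge n → Fin n → Fin n → Set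
Step (edge a b true)  u v = a ≡ u × b ≡ v
Step (edge a b false) u v = (a ≡ u × b ≡ v) ⊎ (a ≡ v × b ≡ u)

-- cyclic successor on Fin (suc k): i ↦ i + 1, last ↦ zero
csuc : ∀ {k} → Fin (suc k) → Fin (suc k)
csuc {zero}  zero    = zero
csuc {suc k} zero    = suc zero
csuc {suc k} (suc i) with csuc {k} i
... | zero  = zero
... | suc j = suc (suc j)

HasSemidirectedCycle : ∀ {n m} → SGraph n m → Set
HasSemidirectedCycle {n} {m} G =
  Σ ℕ λ k → Σ (Fin (suc k) → Fin n) λ vs → Σ (Fin (suc k) → Fin m) λ es →
    Injective _≡_ _≡_ vs × Injective _≡_ _≡_ es ×
    (∀ i → Step (G (es i)) (vs i) (vs (csuc i)))

SDAG : ∀ {n m} → SGraph n m → Set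
SDAG G = WellFormed G × ¬ HasSemidirectedCycle G

DAG : ∀ {n m} → SGraph n m → Set
DAG G = SDAG G × IsDirected G

-- N' is compatible with N : N' obtained from N by directing some undirected edges
CompatEdge : ∀ {n} → Edge n → Edge n → Set
CompatEdge e' (edge a b true)  = e' ≡ edge a b true
CompatEdge e' (edge a b false) =
  e' ≡ edge a b false ⊎ e' ≡ edge a b true ⊎ e' ≡ edge b a true

Compatible : ∀ {n m} → SGraph n m → SGraph n m → Set
Compatible {n} {m} N' N = ∀ (e : Fin m) → CompatEdge (N' e) (N e)

IsHybridNode : ∀ {n m} → SGraph n m → Fin n → Set
IsHybridNode {n} {m} G v = Σ (Fin m) λ e → Σ (Fin m) λ f → e ≢ f ×
  directed (G e) ≡ true × end₂ (G e) ≡ v ×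
  directed (G f) ≡ true × end₂ (G f) ≡ v

IsTreeNode : ∀ {n m} → SGraph n m → Fin n → Set
IsTreeNode G v = ¬ IsHybridNode G v

IsHybridEdge : ∀ {n m} → SGraph n m → Fin m → Set
IsHybridEdge G e = directed (G e) ≡ true × IsHybridNode G (end₂ (G e))

IsTreeEdge : ∀ {n m} → SGraph n m → Fin m → Set
IsTreeEdge G e = directed (G e) ≡ false ⊎
  (directed (G e) ≡ true × IsTreeNode G (end₂ (G e)))

PhyloCompatible : ∀ {n m} → SGraph n m → SGraph n m → Set
PhyloCompatible {n} {m} N' N =
  SDAG N' × SDAG N × Compatible N' N × (∀ (e : Fin m) → IsHybridEdge N' e ⇔ IsHybridEdge N e)

RootedPartner : ∀ {n m} → SGraph n m → SGraph n m → Set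
RootedPartner P N = DAG P × PhyloCompatible P N

IsNetwork : ∀ {n m} → SGraph n m → Set
IsNetwork {n} {m} N = SDAG N × Σ (SGraph n m) λ P → RootedPartner P N

UndirectSomeTreeEdges : ∀ {n m} → SGraph n m → SGraph n m → Set
UndirectSomeTreeEdges {n} {m} N N' = ∀ (e : Fin m) →
  N' e ≡ N e ⊎
  (IsTreeEdge N e × N' e ≡ edge (end₁ (N e)) (end₂ (N e)) false)

-- Fix a rooted partner P of N.  Every edge undirected in N′ is a tree edge of N, so N and N′
-- have the same hybrid edges and P stays compatible with N′; it remains to see that N′ is
-- acyclic.  Traverse a semidirected cycle of N′ in P: each edge is run forwards or backwards,
-- and backwards only if it is undirected in N′, i.e. if its P-child is a tree node.  A forward
-- edge followed by a backward one would give their common head two parents in P, so either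
-- all edges are forward or all are backward, and P contains the cycle or its reverse.
-- Loops and parallel undirected edges are semidirected cycles of length 1 and 2, so
-- well-formedness of N′ comes for free.
module Submission where

open import Defs
open import Data.Nat using (ℕ; zero; suc)
open import Data.Fin using (Fin; zero; suc; inject₁; fromℕ; opposite)
open import Data.Fin.Induction using (<-weakInduction; >-weakInduction)
open import Data.Fin.Properties using (opposite-involutive)
open import Data.Bool using (true; false)
open import Data.Product using (∃; _×_; _,_; proj₁; proj₂; map₂)
open import Data.Sum using (_⊎_; inj₁; inj₂)
open import Data.Empty using (⊥-elim)
open import Function using (_∘_)
open import Function.Bundles using (_⇔_; mk⇔; Equivalence)
open import Function.Construct.Composition using (_⇔-∘_)
open import Function.Definitions using (Injective)
open import Relation.Binary.PropositionalEquality
open import Relation.Nullary using (¬_)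

open ≡-Reasoning

csuc-inject₁ : ∀ {k} (i : Fin k) → csuc (inject₁ i) ≡ suc i
csuc-inject₁ {suc k} zero    = refl
csuc-inject₁ {suc k} (suc i) rewrite csuc-inject₁ i = refl

csuc-fromℕ : ∀ k → csuc (fromℕ k) ≡ zero
csuc-fromℕ zero    = refl
csuc-fromℕ (suc k) rewrite csuc-fromℕ k = refl

csuc-induction : ∀ {k} (F : Fin (suc k) → Set) →
  F zero → (∀ i → F i → F (csuc i)) → ∀ i → F i
csuc-induction F F₀ step =
  <-weakInduction F F₀ (λ i → subst F (csuc-inject₁ i) ∘ step (inject₁ i))

csuc-backwardInduction : ∀ {k} (F : Fin (suc k) → Set) →
  F zero → (∀ i → F (csuc i) → F i) → ∀ i → F i
csuc-backwardInduction {k} F F₀ step =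
  >-weakInduction F (step (fromℕ k) (subst F (sym (csuc-fromℕ k)) F₀))
    (λ i → step (inject₁ i) ∘ subst F (sym (csuc-inject₁ i)))

fromℕ-or-inject₁ : ∀ {k} (j : Fin (suc k)) → j ≡ fromℕ k ⊎ ∃ λ i → j ≡ inject₁ i
fromℕ-or-inject₁ {zero}  zero    = inj₁ refl
fromℕ-or-inject₁ {suc k} zero    = inj₂ (zero , refl)
fromℕ-or-inject₁ {suc k} (suc j) with fromℕ-or-inject₁ j
... | inj₁ refl       = inj₁ refl
... | inj₂ (i , refl) = inj₂ (suc i , refl)

opposite-fromℕ : ∀ k → opposite (fromℕ k) ≡ zero
opposite-fromℕ zero    = refl
opposite-fromℕ (suc k) rewrite opposite-fromℕ k = refl

opposite-inject₁ : ∀ {k} (i : Fin k) → opposite (inject₁ i) ≡ suc (opposite i)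
opposite-inject₁ {suc k} zero    = refl
opposite-inject₁ {suc k} (suc i) rewrite opposite-inject₁ i = refl

opposite-injective : ∀ {k} → Injective _≡_ _≡_ (opposite {k})
opposite-injective {k} {i} {j} eq = begin
  i                     ≡⟨ opposite-involutive i ⟨
  opposite (opposite i) ≡⟨ cong opposite eq ⟩
  opposite (opposite j) ≡⟨ opposite-involutive j ⟩
  j                     ∎

csuc-opposite-csuc : ∀ {k} (j : Fin (suc k)) → csuc (opposite (csuc j)) ≡ opposite j
csuc-opposite-csuc {k} j with fromℕ-or-inject₁ j
... | inj₁ refl = begin
  csuc (opposite (csuc (fromℕ k))) ≡⟨ cong (csuc ∘ opposite) (csuc-fromℕ k) ⟩
  csuc (fromℕ k)                   ≡⟨ csuc-fromℕ k ⟩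
  zero                             ≡⟨ opposite-fromℕ k ⟨
  opposite (fromℕ k)               ∎
... | inj₂ (i , refl) = begin
  csuc (opposite (csuc (inject₁ i))) ≡⟨ cong (csuc ∘ opposite) (csuc-inject₁ i) ⟩
  csuc (inject₁ (opposite i))        ≡⟨ csuc-inject₁ (opposite i) ⟩
  suc (opposite i)                   ≡⟨ opposite-inject₁ i ⟨
  opposite (inject₁ i)               ∎

true≢false : true ≢ false
true≢false ()

undirect : ∀ {n} → Edge n → Edge n
undirect x = edge (end₁ x) (end₂ x) false

step-forward : ∀ {n} (x : Edge n) → Step x (end₁ x) (end₂ x)
step-forward (edge a b true)  = refl , refl
step-forward (edge a b false) = inj₁ (refl , refl)

step-along : ∀ {n} (x : Edge n) {u v} → end₁ x ≡ u → end₂ x ≡ v → Step x u v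
step-along x p q = subst₂ (Step x) p q (step-forward x)

step-backward : ∀ {n} (x : Edge n) → directed x ≡ false → Step x (end₂ x) (end₁ x)
step-backward (edge a b false) refl = inj₂ (refl , refl)

compatible-refl : ∀ {n} (x : Edge n) → CompatEdge x x
compatible-refl (edge a b true)  = refl
compatible-refl (edge a b false) = inj₁ refl

compatible-undirect : ∀ {n} {x y : Edge n} → CompatEdge x y → CompatEdge x (undirect y)
compatible-undirect {y = edge a b true}  c = inj₂ (inj₁ c)
compatible-undirect {y = edge a b false} c = c

compatible-step : ∀ {n} {x y : Edge n} {u v} → directed x ≡ true → CompatEdge x y → Step y u v →
  (end₁ x ≡ u × end₂ x ≡ v) ⊎ (end₁ x ≡ v × end₂ x ≡ u × directed y ≡ false)
compatible-step {y = edge a b true}  _ refl               uv              = inj₁ uv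
compatible-step {y = edge a b false} () (inj₁ refl)
compatible-step {y = edge a b false} _ (inj₂ (inj₁ refl)) (inj₁ uv)       = inj₁ uv
compatible-step {y = edge a b false} _ (inj₂ (inj₁ refl)) (inj₂ (p , q))  = inj₂ (p , q , refl)
compatible-step {y = edge a b false} _ (inj₂ (inj₂ refl)) (inj₁ (p , q))  = inj₂ (q , p , refl)
compatible-step {y = edge a b false} _ (inj₂ (inj₂ refl)) (inj₂ (p , q))  = inj₁ (q , p)

module _ {n m : ℕ} (G : SGraph n m) where

  loop⇒cycle : ∀ e → end₁ (G e) ≡ end₂ (G e) → HasSemidirectedCycle G
  loop⇒cycle e loop =
    0 , (λ _ → end₁ (G e)) , (λ _ → e) , (λ { {zero} {zero} _ → refl }) , (λ { {zero} {zero} _ → refl }) ,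
    λ { zero → step-along (G e) refl (sym loop) }

  twoCycle : ∀ {e f x y} → e ≢ f → x ≢ y → Step (G e) x y → Step (G f) y x → HasSemidirectedCycle G
  twoCycle {e} {f} {x} {y} e≢f x≢y xy yx = 1 , vs , es , vs-inj , es-inj , steps
    where
    vs : Fin 2 → Fin n
    vs zero       = x
    vs (suc zero) = y
    es : Fin 2 → Fin m
    es zero       = e
    es (suc zero) = f
    vs-inj : Injective _≡_ _≡_ vs
    vs-inj {zero}     {zero}     _  = refl
    vs-inj {zero}     {suc zero} eq = ⊥-elim (x≢y eq)
    vs-inj {suc zero} {zero}     eq = ⊥-elim (x≢y (sym eq))
    vs-inj {suc zero} {suc zero} _  = refl
    es-inj : Injective _≡_ _≡_ es
    es-inj {zero}     {zero}     _  = refl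
    es-inj {zero}     {suc zero} eq = ⊥-elim (e≢f eq)
    es-inj {suc zero} {zero}     eq = ⊥-elim (e≢f (sym eq))
    es-inj {suc zero} {suc zero} _  = refl
    steps : ∀ i → Step (G (es i)) (vs i) (vs (csuc i))
    steps zero       = xy
    steps (suc zero) = yx

  reversed⇒cycle : ∀ {k} (vs : Fin (suc k) → Fin n) (es : Fin (suc k) → Fin m) →
    Injective _≡_ _≡_ vs → Injective _≡_ _≡_ es →
    (∀ i → Step (G (es i)) (vs (csuc i)) (vs i)) → HasSemidirectedCycle G
  reversed⇒cycle {k} vs es vs-inj es-inj steps =
    k , vs ∘ opposite , es ∘ opposite ∘ csuc , opposite-injective ∘ vs-inj , es′-inj , steps′
    where
    es′-inj : Injective _≡_ _≡_ (es ∘ opposite ∘ csuc)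
    es′-inj {i} {j} eq = opposite-injective (begin
      opposite i                ≡⟨ csuc-opposite-csuc i ⟨
      csuc (opposite (csuc i))  ≡⟨ cong csuc (es-inj eq) ⟩
      csuc (opposite (csuc j))  ≡⟨ csuc-opposite-csuc j ⟩
      opposite j                ∎)
    steps′ : ∀ j → Step (G (es (opposite (csuc j)))) (vs (opposite j)) (vs (opposite (csuc j)))
    steps′ j = subst (λ i → Step (G (es (opposite (csuc j)))) (vs i) (vs (opposite (csuc j))))
                     (csuc-opposite-csuc j) (steps (opposite (csuc j)))

  acyclic⇒wellFormed : ¬ HasSemidirectedCycle G → WellFormed G
  acyclic⇒wellFormed acyclic = loopless , λ e f e≢f _ df → noParallel e f e≢f df
    where
    loopless : ∀ e → end₁ (G e) ≢ end₂ (G e)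
    loopless e = acyclic ∘ loop⇒cycle e
    noParallel : ∀ e f → e ≢ f → directed (G f) ≡ false → ¬ SamePair (G e) (G f)
    noParallel e f e≢f df (inj₁ (p , q)) = acyclic (twoCycle e≢f (loopless e) (step-forward (G e))
      (subst₂ (Step (G f)) (sym q) (sym p) (step-backward (G f) df)))
    noParallel e f e≢f df (inj₂ (p , q)) =
      acyclic (twoCycle e≢f (loopless e) (step-forward (G e)) (step-along (G f) (sym q) (sym p)))

module CycleLifting {n m : ℕ} {P G : SGraph n m} (P-dag : DAG P) (P≼G : Compatible P G)
  (undirected⇒tree : ∀ e → directed (G e) ≡ false → IsTreeNode P (end₂ (P e)))
  {k : ℕ} {vs : Fin (suc k) → Fin n} {es : Fin (suc k) → Fin m}
  (vs-inj : Injective _≡_ _≡_ vs) (es-inj : Injective _≡_ _≡_ es)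
  (steps : ∀ i → Step (G (es i)) (vs i) (vs (csuc i))) where

  P-loopless : ∀ e → end₁ (P e) ≢ end₂ (P e)
  P-loopless = proj₁ (proj₁ (proj₁ P-dag))

  Forward Backward : Fin (suc k) → Set
  Forward i  = end₁ (P (es i)) ≡ vs i × end₂ (P (es i)) ≡ vs (csuc i)
  Backward i = end₁ (P (es i)) ≡ vs (csuc i) × end₂ (P (es i)) ≡ vs i × directed (G (es i)) ≡ false

  forward-or-backward : ∀ i → Forward i ⊎ Backward i
  forward-or-backward i = compatible-step (proj₂ P-dag (es i)) (P≼G (es i)) (steps i)

  -- Otherwise vs (csuc i) would be the child of the two P-edges es i and es (csuc i),
  -- hence hybrid, while es (csuc i) is undirected in G.
  forward⇒forward : ∀ i → Forward i → Forward (csuc i)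
  forward⇒forward i fwd with forward-or-backward (csuc i)
  ... | inj₁ fwd′            = fwd′
  ... | inj₂ (_ , into , undirected) =
    ⊥-elim (undirected⇒tree (es (csuc i)) undirected
      (es (csuc i) , es i , distinct , proj₂ P-dag _ , refl , proj₂ P-dag _ , trans (proj₂ fwd) (sym into)))
    where
    distinct : es (csuc i) ≢ es i
    distinct eq = P-loopless (es i)
      (trans (proj₁ fwd) (trans (cong vs (sym (es-inj eq))) (sym (proj₂ fwd))))

  backward⇒backward : ∀ i → Backward (csuc i) → Backward i
  backward⇒backward i bwd with forward-or-backward i
  ... | inj₁ fwd  = ⊥-elim (P-loopless (es (csuc i))
                      (trans (proj₁ (forward⇒forward i fwd)) (sym (proj₁ (proj₂ bwd)))))
  ... | inj₂ bwd′ = bwd′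

  P-cycle : HasSemidirectedCycle P
  P-cycle with forward-or-backward zero
  ... | inj₁ fwd = k , vs , es , vs-inj , es-inj , λ i →
    let (p , q) = csuc-induction Forward fwd forward⇒forward i in step-along (P (es i)) p q
  ... | inj₂ bwd = reversed⇒cycle P vs es vs-inj es-inj λ i →
    let (p , q , _) = csuc-backwardInduction Backward bwd backward⇒backward i in step-along (P (es i)) p q

compatibleDAG⇒acyclic : ∀ {n m} {P G : SGraph n m} → DAG P → Compatible P G →
  (∀ e → directed (G e) ≡ false → IsTreeNode P (end₂ (P e))) → ¬ HasSemidirectedCycle G
compatibleDAG⇒acyclic P-dag P≼G undirected⇒tree (_ , _ , _ , vs-inj , es-inj , steps) =
  proj₂ (proj₁ P-dag) (CycleLifting.P-cycle P-dag P≼G undirected⇒tree vs-inj es-inj steps)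

hybridNode-transfer : ∀ {n m} {G H : SGraph n m} {v} →
  (∀ e → directed (G e) ≡ true → end₂ (G e) ≡ v → H e ≡ G e) → IsHybridNode G v → IsHybridNode H v
hybridNode-transfer {G = G} {H} agree (e , f , e≢f , de , ev , df , fv) =
  e , f , e≢f , trans (cong directed eq-e) de , trans (cong end₂ eq-e) ev ,
                trans (cong directed eq-f) df , trans (cong end₂ eq-f) fv
  where
  eq-e : H e ≡ G e
  eq-e = agree e de ev
  eq-f : H f ≡ G f
  eq-f = agree f df fv

module _ {n m : ℕ} {N N′ : SGraph n m} (N⇝N′ : UndirectSomeTreeEdges N N′) where

  directed-preserved : ∀ e → directed (N′ e) ≡ true → N′ e ≡ N e
  directed-preserved e d with N⇝N′ e
  ... | inj₁ same             = same
  ... | inj₂ (_ , undirected) = ⊥-elim (true≢false (trans (sym d) (cong directed undirected)))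

  hybridEdge-preserved : ∀ e → IsHybridEdge N e → N′ e ≡ N e
  hybridEdge-preserved e (d , hybrid) with N⇝N′ e
  ... | inj₁ same                    = same
  ... | inj₂ (inj₁ undirected , _)   = ⊥-elim (true≢false (trans (sym d) undirected))
  ... | inj₂ (inj₂ (_ , tree) , _)   = ⊥-elim (tree hybrid)

  hybridNode-⇔ : ∀ v → IsHybridNode N v ⇔ IsHybridNode N′ v
  hybridNode-⇔ v = mk⇔
    (λ h → hybridNode-transfer (λ e d ev → hybridEdge-preserved e (d , subst (IsHybridNode N) (sym ev) h)) h)
    (hybridNode-transfer (λ e d _ → sym (directed-preserved e d)))

  hybridEdge-⇔ : ∀ e → IsHybridEdge N e ⇔ IsHybridEdge N′ e
  hybridEdge-⇔ e = mk⇔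
    (λ h → subst (HybridEdgeOf N′) (sym (hybridEdge-preserved e h)) (map₂ (Equivalence.to (hybridNode-⇔ _)) h))
    (λ h → subst (HybridEdgeOf N) (directed-preserved e (proj₁ h)) (map₂ (Equivalence.from (hybridNode-⇔ _)) h))
    where
    HybridEdgeOf : SGraph n m → Edge n → Set
    HybridEdgeOf G x = directed x ≡ true × IsHybridNode G (end₂ x)

  compatible-preserved : ∀ {P : SGraph n m} → Compatible P N → Compatible P N′
  compatible-preserved P≼N e with N⇝N′ e
  ... | inj₁ same             rewrite same       = P≼N e
  ... | inj₂ (_ , undirected) rewrite undirected = compatible-undirect (P≼N e)

  compatible-undirecting : Compatible N N′
  compatible-undirecting = compatible-preserved {P = N} (compatible-refl ∘ N)

  undirected⇒treeChild : ∀ {P : SGraph n m} → IsDirected P → (∀ e → IsHybridEdge P e ⇔ IsHybridEdge N e) →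
    ∀ e → directed (N′ e) ≡ false → IsTreeNode P (end₂ (P e))
  undirected⇒treeChild P-directed P≈N e undirected hybrid =
    true≢false (trans (sym (proj₁ hybridN)) (trans (cong directed (sym (hybridEdge-preserved e hybridN))) undirected))
    where
    hybridN : IsHybridEdge N e
    hybridN = Equivalence.to (P≈N e) (P-directed e , hybrid)

proposition2 : ∀ {n m : ℕ} (N N' : SGraph n m) →
    IsNetwork N → UndirectSomeTreeEdges N N' →
    IsNetwork N' × PhyloCompatible N N'
proposition2 N N′ (N-sdag , P , P-dag , (_ , _ , P≼N , P≈N)) N⇝N′ =
  (N′-sdag , P , P-dag , (proj₁ P-dag , N′-sdag , P≼N′ , P≈N′)) ,
  (N-sdag , N′-sdag , compatible-undirecting N⇝N′ , hybridEdge-⇔ N⇝N′)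
  where
  P≼N′ : Compatible P N′
  P≼N′ = compatible-preserved N⇝N′ P≼N
  P≈N′ : ∀ e → IsHybridEdge P e ⇔ IsHybridEdge N′ e
  P≈N′ e = hybridEdge-⇔ N⇝N′ e ⇔-∘ P≈N e
  N′-acyclic : ¬ HasSemidirectedCycle N′
  N′-acyclic = compatibleDAG⇒acyclic P-dag P≼N′ (undirected⇒treeChild N⇝N′ {P} (proj₂ P-dag) P≈N)
  N′-sdag : SDAG N′
  N′-sdag = acyclic⇒wellFormed N′ N′-acyclic , N′-acyclic
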